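{- Let $W=\sum_{n\ge0}W_n\frac{X^n}{n!}\in\mathbb C[[X]]$. Define $G_0=1$, $G_{n+1}=(WG_n)'$ (derivative in $X$), and $Z_0=\sum_{n\ge0}([X^0]G_n)\frac{s^n}{n!}=\sum_{n\ge0}\zeta_ns^n\in\mathbb C[[s]]$. Then $U=\sum_{n\ge0}\zeta_n\frac{s^{n+1}}{n+1}\in s\mathbb C[[s]]$ is a formal solution of the differential equation $$W_0\,U'=W\circ(W_0U)$$ with initial condition $U(0)=0$ (here $U'=dU/ds$).
   Context: $[X^0]G$ denotes the constant term of $G\in\mathbb C[[X]]$. -}

module Defs where

open import Level using (Level)
open import Data.Nat using (ℕ; zero; suc; _∸_)
open import Algebra.Bundles using (CommutativeRing)

-- Formal power series over a commutative ring R, represented by their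
-- (ordinary) coefficient sequences: f = Σ f n · X^n.
module PowerSeries {c ℓ : Level} (R : CommutativeRing c ℓ) where
  open CommutativeRing R

  Series : Set c
  Series = ℕ → Carrier

  _⊗_ : ℕ → Carrier → Carrier
  zero  ⊗ x = 0#
  suc n ⊗ x = x + (n ⊗ x)

  sumTo : ℕ → (ℕ → Carrier) → Carrier
  sumTo zero    f = 0#
  sumTo (suc n) f = sumTo n f + f n

  one : Series
  one zero    = 1#
  one (suc n) = 0#

  scale : Carrier → Series → Series
  scale a f n = a * f n

  mul : Series → Series → Series
  mul f g n = sumTo (suc n) (λ i → f i * g (n ∸ i))

  deriv : Series → Series
  deriv f n = suc n ⊗ f (suc n)

  pow : Series → ℕ → Series
  pow g zero    = one
  pow g (suc k) = mul g (pow g k)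

  -- composition f ∘ g, for g with zero constant term:
  -- [X^n](f ∘ g) = Σ_{k ≤ n} f_k [X^n] g^k   (exact when g 0 = 0)
  comp : Series → Series → Series
  comp f g n = sumTo (suc n) (λ k → f k * pow g k n)

  -- Data of the theorem: inv n is an inverse of (n+1)·1 in R.
  -- invFact n = 1/n!
  invFact : (ℕ → Carrier) → ℕ → Carrier
  invFact inv zero    = 1#
  invFact inv (suc n) = inv n * invFact inv n

  Wser : (ℕ → Carrier) → (ℕ → Carrier) → Series
  Wser inv Wₙ n = Wₙ n * invFact inv n

  G : Series → ℕ → Series
  G W zero    = one
  G W (suc n) = deriv (mul W (G W n))

  ζ : (ℕ → Carrier) → (ℕ → Carrier) → ℕ → Carrier
  ζ inv Wₙ n = G (Wser inv Wₙ) n 0 * invFact inv n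

  U : (ℕ → Carrier) → (ℕ → Carrier) → Series
  U inv Wₙ zero    = 0#
  U inv Wₙ (suc n) = ζ inv Wₙ n * inv n

{-# OPTIONS --safe #-}

-- With V = W₀U the equation reads V′ = W ∘ V, because differentiating U undoes the factor
-- 1/(n+1): U′ = Z₀. Composition with a series V with V(0) = 0 is multiplicative and obeys the
-- chain rule (f ∘ V)′ = (f′ ∘ V)·V′. Hence, if V′ and W ∘ V agree in degrees < n, then
-- [Xⁿ](f ∘ V) = [X⁰](Lⁿ f)/n! for the derivation L f = f′·W, by induction on n for all f at once.
-- Since W·G_{k+1} = W·(W·G_k)′ = L(W·G_k), we have Lⁿ W = W·Gₙ, so
-- [Xⁿ](W ∘ V) = W₀ [X⁰]Gₙ / n! = W₀ζₙ = [Xⁿ]V′, and strong induction on n gives V′ = W ∘ V.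

module Submission where

open import Defs
open import Level using (Level)
open import Algebra.Bundles using (CommutativeRing)
open import Data.Nat using (ℕ; zero; suc; _∸_; _≤_; _<_; _≤′_; ≤′-refl; ≤′-step; z<s; s≤s)
import Data.Nat.Properties as ℕ
open import Data.Nat.Induction using (<-rec)
open import Data.Nat.GeneralisedArithmetic using (fold; iterate; iterate-is-fold)
open import Data.Product using (_×_; _,_)
open import Function using (_∘_)
open import Relation.Binary.Bundles using (Setoid)
open import Function.Indexed.Relation.Binary.Equality using (≡-setoid)
import Relation.Binary.Indexed.Heterogeneous.Construct.Trivial as Trivial
import Relation.Binary.PropositionalEquality as ≡
import Relation.Binary.Reasoning.Setoid as SetoidReasoning
import Algebra.Properties.CommutativeSemigroup

module FormalPowerSeries {c ℓ : Level} (R : CommutativeRing c ℓ) where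
  open CommutativeRing R hiding (zero)
  open PowerSeries R
  open import Algebra.Properties.Semiring.Mult semiring
    using (×-congʳ; ×-homo-+; ×-assoc-*) renaming (_×_ to _×ᴺ_)
  private
    module +-CS = Algebra.Properties.CommutativeSemigroup +-commutativeSemigroup
    module *-CS = Algebra.Properties.CommutativeSemigroup *-commutativeSemigroup
    module ≈-Reasoning = SetoidReasoning setoid

  ι : ℕ → Carrier
  ι n = n ×ᴺ 1#

  ⊗≈× : ∀ n x → n ⊗ x ≈ n ×ᴺ x
  ⊗≈× zero    x = refl
  ⊗≈× (suc n) x = +-congˡ (⊗≈× n x)

  ⊗≈ι* : ∀ n x → n ⊗ x ≈ ι n * x
  ⊗≈ι* n x = begin
    n ⊗ x         ≈⟨ ⊗≈× n x ⟩
    n ×ᴺ x        ≈⟨ ×-congʳ n (*-identityˡ x) ⟨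
    n ×ᴺ (1# * x) ≈⟨ ×-assoc-* n 1# x ⟨
    ι n * x       ∎
    where open ≈-Reasoning

  ⊗-congʳ : ∀ n {x y} → x ≈ y → n ⊗ x ≈ n ⊗ y
  ⊗-congʳ n {x} {y} x≈y = trans (⊗≈ι* n x) (trans (*-congˡ x≈y) (sym (⊗≈ι* n y)))

  sumTo-cong : ∀ n {f g : ℕ → Carrier} → (∀ {i} → i < n → f i ≈ g i) → sumTo n f ≈ sumTo n g
  sumTo-cong zero    f≈g = refl
  sumTo-cong (suc n) f≈g = +-cong (sumTo-cong n (f≈g ∘ ℕ.m<n⇒m<1+n)) (f≈g (ℕ.n<1+n n))

  sumTo-zero : ∀ n {f : ℕ → Carrier} → (∀ {i} → i < n → f i ≈ 0#) → sumTo n f ≈ 0#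
  sumTo-zero zero    f≈0 = refl
  sumTo-zero (suc n) f≈0 =
    trans (+-cong (sumTo-zero n (f≈0 ∘ ℕ.m<n⇒m<1+n)) (f≈0 (ℕ.n<1+n n))) (+-identityʳ 0#)

  sumTo-+ : ∀ n (f g : ℕ → Carrier) → sumTo n (λ i → f i + g i) ≈ sumTo n f + sumTo n g
  sumTo-+ zero    f g = sym (+-identityʳ 0#)
  sumTo-+ (suc n) f g = trans (+-congʳ (sumTo-+ n f g)) (+-CS.interchange _ _ _ _)

  *-distribˡ-sumTo : ∀ n a (f : ℕ → Carrier) → a * sumTo n f ≈ sumTo n (λ i → a * f i)
  *-distribˡ-sumTo zero    a f = zeroʳ a
  *-distribˡ-sumTo (suc n) a f = trans (distribˡ a _ _) (+-congʳ (*-distribˡ-sumTo n a f))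

  sumTo-head : ∀ n (f : ℕ → Carrier) → sumTo (suc n) f ≈ f 0 + sumTo n (f ∘ suc)
  sumTo-head zero    f = +-comm 0# (f 0)
  sumTo-head (suc n) f = trans (+-congʳ (sumTo-head n f)) (+-assoc _ _ _)

  sumTo-swap : ∀ n m (a : ℕ → ℕ → Carrier) →
    sumTo n (λ i → sumTo m (a i)) ≈ sumTo m (λ j → sumTo n (λ i → a i j))
  sumTo-swap zero    m a = sym (sumTo-zero m (λ _ → refl))
  sumTo-swap (suc n) m a = trans (+-congʳ (sumTo-swap n m a)) (sym (sumTo-+ m _ _))

  sumTo-vanishing-tail : ∀ {n m} {f : ℕ → Carrier} → n ≤ m → (∀ {j} → n ≤ j → f j ≈ 0#) →
    sumTo m f ≈ sumTo n f
  sumTo-vanishing-tail {n} {f = f} n≤m f≈0 = drop (ℕ.≤⇒≤′ n≤m)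
    where
    drop : ∀ {m} → n ≤′ m → sumTo m f ≈ sumTo n f
    drop ≤′-refl        = refl
    drop (≤′-step n≤′m) = trans (+-cong (drop n≤′m) (f≈0 (ℕ.≤′⇒≤ n≤′m))) (+-identityʳ _)

  ≈ₛ-setoid : Setoid c ℓ
  ≈ₛ-setoid = ≡-setoid ℕ (Trivial.indexedSetoid setoid)

  infix 4 _≈ₛ_ _≈[<_]_
  infixl 6 _+ₛ_

  _≈ₛ_ : Series → Series → Set ℓ
  _≈ₛ_ = Setoid._≈_ ≈ₛ-setoid

  _≈[<_]_ : Series → ℕ → Series → Set ℓ
  f ≈[< n ] g = ∀ {j} → j < n → f j ≈ g j

  _+ₛ_ : Series → Series → Series
  (f +ₛ g) n = f n + g n

  shift : Series → Series
  shift f n = f (suc n)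

  private module ≈ₛ-Reasoning = SetoidReasoning ≈ₛ-setoid

  +ₛ-cong : ∀ {f f′ g g′} → f ≈ₛ f′ → g ≈ₛ g′ → f +ₛ g ≈ₛ f′ +ₛ g′
  +ₛ-cong f≈f′ g≈g′ n = +-cong (f≈f′ n) (g≈g′ n)

  +ₛ-assoc : ∀ f g h → (f +ₛ g) +ₛ h ≈ₛ f +ₛ (g +ₛ h)
  +ₛ-assoc f g h n = +-assoc (f n) (g n) (h n)

  mul-congʳ-≤ : ∀ n {f g g′} → g ≈[< suc n ] g′ → mul f g n ≈ mul f g′ n
  mul-congʳ-≤ n g≈g′ = sumTo-cong (suc n) λ {i} _ → *-congˡ (g≈g′ (s≤s (ℕ.m∸n≤m n i)))

  mul-cong : ∀ {f f′ g g′} → f ≈ₛ f′ → g ≈ₛ g′ → mul f g ≈ₛ mul f′ g′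
  mul-cong f≈f′ g≈g′ n = sumTo-cong (suc n) λ {i} _ → *-cong (f≈f′ i) (g≈g′ (n ∸ i))

  mul-congʳ-< : ∀ n {f g g′} → f 0 ≈ 0# → g ≈[< n ] g′ → mul f g n ≈ mul f g′ n
  mul-congʳ-< n {f} {g} {g′} f₀≈0 g≈g′ = sumTo-cong (suc n) term
    where
    f₀*≈0 : ∀ x → f 0 * x ≈ 0#
    f₀*≈0 x = trans (*-congʳ f₀≈0) (zeroˡ x)
    term : ∀ {i} → i < suc n → f i * g (n ∸ i) ≈ f i * g′ (n ∸ i)
    term {zero}  _           = trans (f₀*≈0 _) (sym (f₀*≈0 _))
    term {suc i} (s≤s 1+i≤n) = *-congˡ (g≈g′ (ℕ.∸-monoʳ-< z<s 1+i≤n))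

  mul-shift : ∀ f g → shift (mul f g) ≈ₛ scale (f 0) (shift g) +ₛ mul (shift f) g
  mul-shift f g n = sumTo-head (suc n) (λ i → f i * g (suc n ∸ i))

  mul-shiftʳ : ∀ f g n → mul f g (suc n) ≈ mul f (shift g) n + f (suc n) * g 0
  mul-shiftʳ f g n = +-cong
    (sumTo-cong (suc n) λ i<1+n → *-congˡ (reflexive (≡.cong g (ℕ.+-∸-assoc 1 (ℕ.≤-pred i<1+n)))))
    (*-congˡ (reflexive (≡.cong g (ℕ.n∸n≡0 n))))

  mul-comm : ∀ f g → mul f g ≈ₛ mul g f
  mul-comm f g zero    = +-congˡ (*-comm (f 0) (g 0))
  mul-comm f g (suc n) = begin
    mul f g (suc n)                     ≈⟨ mul-shift f g n ⟩
    f 0 * g (suc n) + mul (shift f) g n ≈⟨ +-cong (*-comm _ _) (mul-comm (shift f) g n) ⟩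
    g (suc n) * f 0 + mul g (shift f) n ≈⟨ +-comm _ _ ⟩
    mul g (shift f) n + g (suc n) * f 0 ≈⟨ mul-shiftʳ g f n ⟨
    mul g f (suc n)                     ∎
    where open ≈-Reasoning

  mul-distribʳ : ∀ f g h → mul (f +ₛ g) h ≈ₛ mul f h +ₛ mul g h
  mul-distribʳ f g h n = trans (sumTo-cong (suc n) λ _ → distribʳ _ _ _) (sumTo-+ (suc n) _ _)

  mul-distribˡ : ∀ f g h → mul f (g +ₛ h) ≈ₛ mul f g +ₛ mul f h
  mul-distribˡ f g h n = trans (sumTo-cong (suc n) λ _ → distribˡ _ _ _) (sumTo-+ (suc n) _ _)

  mul-scaleˡ : ∀ a f g → mul (scale a f) g ≈ₛ scale a (mul f g)
  mul-scaleˡ a f g n =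
    trans (sumTo-cong (suc n) λ _ → *-assoc _ _ _) (sym (*-distribˡ-sumTo (suc n) a _))

  mul-scaleʳ : ∀ a f g → mul f (scale a g) ≈ₛ scale a (mul f g)
  mul-scaleʳ a f g n =
    trans (sumTo-cong (suc n) λ _ → *-CS.x∙yz≈y∙xz _ _ _) (sym (*-distribˡ-sumTo (suc n) a _))

  mul-assoc : ∀ f g h → mul (mul f g) h ≈ₛ mul f (mul g h)
  mul-assoc f g h zero    =
    +-congˡ (trans (*-congʳ (+-identityˡ _)) (trans (*-assoc _ _ _) (*-congˡ (sym (+-identityˡ _)))))
  mul-assoc f g h (suc n) = begin
    mul (mul f g) h (suc n)                              ≈⟨ mul-shift (mul f g) h n ⟩
    mul f g 0 * h (suc n) + mul (shift (mul f g)) h n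
      ≈⟨ +-cong (*-congʳ (+-identityˡ _)) (mul-cong {g = h} (mul-shift f g) (λ _ → refl) n) ⟩
    f 0 * g 0 * h (suc n) + mul (scale (f 0) (shift g) +ₛ mul (shift f) g) h n
      ≈⟨ +-congˡ (mul-distribʳ _ _ h n) ⟩
    f 0 * g 0 * h (suc n) + (mul (scale (f 0) (shift g)) h n + mul (mul (shift f) g) h n)
      ≈⟨ +-cong (*-assoc _ _ _) (+-cong (mul-scaleˡ (f 0) (shift g) h n) (mul-assoc (shift f) g h n)) ⟩
    f 0 * (g 0 * h (suc n)) + (f 0 * mul (shift g) h n + mul (shift f) (mul g h) n)
      ≈⟨ +-assoc _ _ _ ⟨
    f 0 * (g 0 * h (suc n)) + f 0 * mul (shift g) h n + mul (shift f) (mul g h) n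
      ≈⟨ +-congʳ (trans (sym (distribˡ (f 0) _ _)) (*-congˡ (sym (mul-shift g h n)))) ⟩
    f 0 * mul g h (suc n) + mul (shift f) (mul g h) n    ≈⟨ mul-shift f (mul g h) n ⟨
    mul f (mul g h) (suc n)                              ∎
    where open ≈-Reasoning

  mul-identityˡ : ∀ g → mul one g ≈ₛ g
  mul-identityˡ g zero    = trans (+-identityˡ _) (*-identityˡ _)
  mul-identityˡ g (suc n) = begin
    mul one g (suc n)                       ≈⟨ mul-shift one g n ⟩
    1# * g (suc n) + mul (shift one) g n
      ≈⟨ +-cong (*-identityˡ _) (sumTo-zero (suc n) λ _ → zeroˡ _) ⟩
    g (suc n) + 0#                          ≈⟨ +-identityʳ _ ⟩
    g (suc n)                               ∎
    where open ≈-Reasoning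

  mul-identityʳ : ∀ f → mul f one ≈ₛ f
  mul-identityʳ f n = trans (mul-comm f one n) (mul-identityˡ f n)

  ι-split : ∀ {i n} → i ≤ n → ι n ≈ ι i + ι (n ∸ i)
  ι-split {i} {n} i≤n =
    trans (reflexive (≡.cong ι (≡.sym (ℕ.m+[n∸m]≡n i≤n)))) (×-homo-+ 1# i (n ∸ i))

  -- X d/dX preserves degrees, which makes its Leibniz rule a coefficientwise identity.
  euler : Series → Series
  euler f n = n ⊗ f n

  euler-mul : ∀ f g → euler (mul f g) ≈ₛ mul (euler f) g +ₛ mul f (euler g)
  euler-mul f g n = begin
    n ⊗ mul f g n                                   ≈⟨ ⊗≈ι* n _ ⟩
    ι n * sumTo (suc n) (λ i → f i * g (n ∸ i))     ≈⟨ *-distribˡ-sumTo (suc n) (ι n) _ ⟩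
    sumTo (suc n) (λ i → ι n * (f i * g (n ∸ i)))   ≈⟨ sumTo-cong (suc n) split ⟩
    sumTo (suc n) (λ i → euler f i * g (n ∸ i) + f i * euler g (n ∸ i)) ≈⟨ sumTo-+ (suc n) _ _ ⟩
    mul (euler f) g n + mul f (euler g) n           ∎
    where
    open ≈-Reasoning
    split : ∀ {i} → i < suc n →
            ι n * (f i * g (n ∸ i)) ≈ euler f i * g (n ∸ i) + f i * euler g (n ∸ i)
    split {i} i<1+n = begin
      ι n * (f i * g (n ∸ i))                                  ≈⟨ *-congʳ (ι-split (ℕ.≤-pred i<1+n)) ⟩
      (ι i + ι (n ∸ i)) * (f i * g (n ∸ i))                    ≈⟨ distribʳ _ _ _ ⟩
      ι i * (f i * g (n ∸ i)) + ι (n ∸ i) * (f i * g (n ∸ i))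
        ≈⟨ +-cong (*-assoc _ _ _) (*-CS.x∙yz≈y∙xz _ _ _) ⟨
      ι i * f i * g (n ∸ i) + f i * (ι (n ∸ i) * g (n ∸ i))
        ≈⟨ +-cong (*-congʳ (⊗≈ι* i (f i))) (*-congˡ (⊗≈ι* (n ∸ i) _)) ⟨
      euler f i * g (n ∸ i) + f i * euler g (n ∸ i)            ∎

  mul-euler : ∀ f g n → mul (euler f) g (suc n) ≈ mul (deriv f) g n
  mul-euler f g n = trans (mul-shift (euler f) g n) (trans (+-congʳ (zeroˡ _)) (+-identityˡ _))

  deriv-mul : ∀ f g → deriv (mul f g) ≈ₛ mul (deriv f) g +ₛ mul f (deriv g)
  deriv-mul f g n = begin
    deriv (mul f g) n                                   ≈⟨ euler-mul f g (suc n) ⟩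
    mul (euler f) g (suc n) + mul f (euler g) (suc n)
      ≈⟨ +-cong (mul-euler f g n) (mul-comm f (euler g) (suc n)) ⟩
    mul (deriv f) g n + mul (euler g) f (suc n)
      ≈⟨ +-congˡ (trans (mul-euler g f n) (mul-comm (deriv g) f n)) ⟩
    mul (deriv f) g n + mul f (deriv g) n               ∎
    where open ≈-Reasoning

  deriv-cong : ∀ {f g} → f ≈ₛ g → deriv f ≈ₛ deriv g
  deriv-cong f≈g n = ⊗-congʳ (suc n) (f≈g (suc n))

  deriv-scale : ∀ a f → deriv (scale a f) ≈ₛ scale a (deriv f)
  deriv-scale a f n = begin
    suc n ⊗ (a * f (suc n))      ≈⟨ ⊗≈ι* (suc n) _ ⟩
    ι (suc n) * (a * f (suc n))  ≈⟨ *-CS.x∙yz≈y∙xz _ _ _ ⟩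
    a * (ι (suc n) * f (suc n))  ≈⟨ *-congˡ (⊗≈ι* (suc n) _) ⟨
    a * deriv f n                ∎
    where open ≈-Reasoning

  lie : Series → Series → Series
  lie W f = mul (deriv f) W

  lie-cong : ∀ W {f g} → f ≈ₛ g → lie W f ≈ₛ lie W g
  lie-cong W f≈g = mul-cong {g = W} (deriv-cong f≈g) (λ _ → refl)

  module _ {inv : ℕ → Carrier} (inv-inverse : ∀ n → suc n ⊗ inv n ≈ 1#) where

    ι*inv≈1 : ∀ n → ι (suc n) * inv n ≈ 1#
    ι*inv≈1 n = trans (sym (⊗≈ι* (suc n) (inv n))) (inv-inverse n)

    inv*⊗ : ∀ n x → inv n * (suc n ⊗ x) ≈ x
    inv*⊗ n x = begin
      inv n * (suc n ⊗ x)         ≈⟨ *-congˡ (⊗≈ι* (suc n) x) ⟩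
      inv n * (ι (suc n) * x)     ≈⟨ *-CS.x∙yz≈yx∙z _ _ _ ⟩
      ι (suc n) * inv n * x       ≈⟨ *-congʳ (ι*inv≈1 n) ⟩
      1# * x                      ≈⟨ *-identityˡ x ⟩
      x                           ∎
      where open ≈-Reasoning

    ⊗*inv : ∀ n x → suc n ⊗ (x * inv n) ≈ x
    ⊗*inv n x = begin
      suc n ⊗ (x * inv n)         ≈⟨ ⊗≈ι* (suc n) _ ⟩
      ι (suc n) * (x * inv n)     ≈⟨ *-CS.x∙yz≈y∙xz _ _ _ ⟩
      x * (ι (suc n) * inv n)     ≈⟨ *-congˡ (ι*inv≈1 n) ⟩
      x * 1#                      ≈⟨ *-identityʳ x ⟩
      x                           ∎
      where open ≈-Reasoning

  module Composition (V : Series) (V₀≈0 : V 0 ≈ 0#) where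

    pow-vanishes : ∀ k {j} → j < k → pow V k j ≈ 0#
    pow-vanishes (suc k) {j} (s≤s j≤k) = begin
      mul V (pow V k) j     ≈⟨ mul-congʳ-< j V₀≈0 (λ i<j → pow-vanishes k (ℕ.<-≤-trans i<j j≤k)) ⟩
      mul V (λ _ → 0#) j    ≈⟨ sumTo-zero (suc j) (λ _ → zeroʳ _) ⟩
      0#                    ∎
      where open ≈-Reasoning

    comp-padded : ∀ f {n m} → n < m → comp f V n ≈ sumTo m (λ k → f k * pow V k n)
    comp-padded f n<m =
      sym (sumTo-vanishing-tail n<m λ n<j → trans (*-congˡ (pow-vanishes _ n<j)) (zeroʳ _))

    comp-congˡ : ∀ {f g} → f ≈ₛ g → comp f V ≈ₛ comp g V
    comp-congˡ f≈g n = sumTo-cong (suc n) λ {k} _ → *-congʳ (f≈g k)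

    comp-+ : ∀ f g → comp (f +ₛ g) V ≈ₛ comp f V +ₛ comp g V
    comp-+ f g n = trans (sumTo-cong (suc n) λ _ → distribʳ _ _ _) (sumTo-+ (suc n) _ _)

    comp-scale : ∀ a f → comp (scale a f) V ≈ₛ scale a (comp f V)
    comp-scale a f n =
      trans (sumTo-cong (suc n) λ _ → *-assoc _ _ _) (sym (*-distribˡ-sumTo (suc n) a _))

    comp-0 : ∀ f → comp f V 0 ≈ f 0
    comp-0 f = trans (+-identityˡ _) (*-identityʳ _)

    comp-suc : ∀ f n → comp f V (suc n) ≈ mul V (comp (shift f) V) (suc n)
    comp-suc f n = begin
      comp f V N
        ≈⟨ comp-padded f (ℕ.m<n⇒m<1+n (ℕ.n<1+n N)) ⟩
      sumTo (suc (suc N)) (λ k → f k * pow V k N)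
        ≈⟨ sumTo-head (suc N) _ ⟩
      f 0 * 0# + sumTo (suc N) (λ k → f (suc k) * mul V (pow V k) N)
        ≈⟨ trans (+-congʳ (zeroʳ _)) (+-identityˡ _) ⟩
      sumTo (suc N) (λ k → f (suc k) * mul V (pow V k) N)
        ≈⟨ sumTo-cong (suc N) (λ _ →
             trans (*-distribˡ-sumTo (suc N) _ _) (sumTo-cong (suc N) λ _ → *-CS.x∙yz≈y∙xz _ _ _)) ⟩
      sumTo (suc N) (λ k → sumTo (suc N) (λ i → V i * (f (suc k) * pow V k (N ∸ i))))
        ≈⟨ sumTo-swap (suc N) (suc N) _ ⟩
      sumTo (suc N) (λ i → sumTo (suc N) (λ k → V i * (f (suc k) * pow V k (N ∸ i))))
        ≈⟨ sumTo-cong (suc N) (λ _ → sym (*-distribˡ-sumTo (suc N) _ _)) ⟩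
      sumTo (suc N) (λ i → V i * sumTo (suc N) (λ k → f (suc k) * pow V k (N ∸ i)))
        ≈⟨ sumTo-cong (suc N) (λ {i} _ → *-congˡ (comp-padded (shift f) (s≤s (ℕ.m∸n≤m N i)))) ⟨
      mul V (comp (shift f) V) N
        ∎
      where
      open ≈-Reasoning
      N = suc n

    comp-unfold : ∀ f → comp f V ≈ₛ scale (f 0) one +ₛ mul V (comp (shift f) V)
    comp-unfold f zero    = begin
      comp f V 0                                ≈⟨ +-identityˡ _ ⟩
      f 0 * 1#                                  ≈⟨ +-identityʳ _ ⟨
      f 0 * 1# + 0#
        ≈⟨ +-congˡ (trans (+-identityˡ _) (trans (*-congʳ V₀≈0) (zeroˡ _))) ⟨
      f 0 * 1# + mul V (comp (shift f) V) 0     ∎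
      where open ≈-Reasoning
    comp-unfold f (suc n) = trans (comp-suc f n) (sym (trans (+-congʳ (zeroʳ _)) (+-identityˡ _)))

    comp-mul : ∀ n f g → comp (mul f g) V n ≈ mul (comp f V) (comp g V) n
    comp-mul = <-rec _ step
      where
      step : ∀ n → (∀ {j} → j < n → ∀ f g → comp (mul f g) V j ≈ mul (comp f V) (comp g V) j) →
             ∀ f g → comp (mul f g) V n ≈ mul (comp f V) (comp g V) n
      step zero    _  f g = trans (comp-0 (mul f g)) (+-congˡ (sym (*-cong (comp-0 f) (comp-0 g))))
      step (suc m) ih f g = begin
        comp (mul f g) V (suc m)                             ≈⟨ comp-suc (mul f g) m ⟩
        mul V (comp (shift (mul f g)) V) (suc m)             ≈⟨ mul-congʳ-< (suc m) V₀≈0 shifted ⟩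
        mul V (scale (f 0) H′ +ₛ mul F H) (suc m)
          ≈⟨ mul-distribˡ V (scale (f 0) H′) (mul F H) (suc m) ⟩
        mul V (scale (f 0) H′) (suc m) + mul V (mul F H) (suc m)
          ≈⟨ +-cong (sym (mul-scaleʳ (f 0) V H′ (suc m))) (mul-assoc V F H (suc m)) ⟨
        f 0 * mul V H′ (suc m) + mul (mul V F) H (suc m)     ≈⟨ +-congʳ (*-congˡ (comp-suc g m)) ⟨
        f 0 * H (suc m) + mul (mul V F) H (suc m)
          ≈⟨ +-congʳ (trans (mul-scaleˡ (f 0) one H (suc m)) (*-congˡ (mul-identityˡ H (suc m)))) ⟨
        mul (scale (f 0) one) H (suc m) + mul (mul V F) H (suc m)
          ≈⟨ mul-distribʳ (scale (f 0) one) (mul V F) H (suc m) ⟨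
        mul (scale (f 0) one +ₛ mul V F) H (suc m)
          ≈⟨ mul-cong {g = H} (comp-unfold f) (λ _ → refl) (suc m) ⟨
        mul (comp f V) H (suc m)                             ∎
        where
        open ≈-Reasoning
        F H H′ : Series
        F  = comp (shift f) V
        H  = comp g V
        H′ = comp (shift g) V
        shifted : comp (shift (mul f g)) V ≈[< suc m ] scale (f 0) H′ +ₛ mul F H
        shifted {j} j<1+m = begin
          comp (shift (mul f g)) V j                                ≈⟨ comp-congˡ (mul-shift f g) j ⟩
          comp (scale (f 0) (shift g) +ₛ mul (shift f) g) V j       ≈⟨ comp-+ _ _ j ⟩
          comp (scale (f 0) (shift g)) V j + comp (mul (shift f) g) V j
            ≈⟨ +-cong (comp-scale (f 0) (shift g) j) (ih j<1+m (shift f) g) ⟩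
          f 0 * H′ j + mul F H j                                    ∎

    comp-deriv-unfold : ∀ f → comp (deriv f) V ≈ₛ comp (shift f) V +ₛ mul V (comp (deriv (shift f)) V)
    comp-deriv-unfold f = begin
      comp (deriv f) V
        ≈⟨ comp-unfold (deriv f) ⟩
      scale (deriv f 0) one +ₛ mul V (comp (shift (shift f) +ₛ deriv (shift f)) V)
        ≈⟨ +ₛ-cong (λ _ → *-congʳ (+-identityʳ (f 1))) (mul-cong (λ _ → refl) (comp-+ _ _)) ⟩
      scale (f 1) one +ₛ mul V (comp (shift (shift f)) V +ₛ D)
        ≈⟨ +ₛ-cong (λ _ → refl) (mul-distribˡ V (comp (shift (shift f)) V) D) ⟩
      scale (f 1) one +ₛ (mul V (comp (shift (shift f)) V) +ₛ mul V D)
        ≈⟨ +ₛ-assoc _ _ _ ⟨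
      scale (f 1) one +ₛ mul V (comp (shift (shift f)) V) +ₛ mul V D
        ≈⟨ +ₛ-cong (comp-unfold (shift f)) (λ _ → refl) ⟨
      comp (shift f) V +ₛ mul V D
        ∎
      where
      open ≈ₛ-Reasoning
      D : Series
      D = comp (deriv (shift f)) V

    comp-deriv : ∀ n f → deriv (comp f V) n ≈ mul (comp (deriv f) V) (deriv V) n
    comp-deriv = <-rec _ step
      where
      step : ∀ n → (∀ {j} → j < n → ∀ f → deriv (comp f V) j ≈ mul (comp (deriv f) V) (deriv V) j) →
             ∀ f → deriv (comp f V) n ≈ mul (comp (deriv f) V) (deriv V) n
      step n ih f = begin
        deriv (comp f V) n                  ≈⟨ ⊗-congʳ (suc n) (comp-suc f n) ⟩
        deriv (mul V F) n                   ≈⟨ deriv-mul V F n ⟩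
        mul V′ F n + mul V (deriv F) n      ≈⟨ +-congˡ (mul-congʳ-< n V₀≈0 λ j<n → ih j<n (shift f)) ⟩
        mul V′ F n + mul V (mul D V′) n     ≈⟨ +-cong (mul-comm F V′ n) (mul-assoc V D V′ n) ⟨
        mul F V′ n + mul (mul V D) V′ n     ≈⟨ mul-distribʳ F (mul V D) V′ n ⟨
        mul (F +ₛ mul V D) V′ n             ≈⟨ mul-cong {g = V′} (comp-deriv-unfold f) (λ _ → refl) n ⟨
        mul (comp (deriv f) V) V′ n         ∎
        where
        open ≈-Reasoning
        F D V′ : Series
        F  = comp (shift f) V
        D  = comp (deriv (shift f)) V
        V′ = deriv V

    module _ {inv : ℕ → Carrier} (inv-inverse : ∀ n → suc n ⊗ inv n ≈ 1#) (W : Series) where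

      comp-taylor : ∀ n → deriv V ≈[< n ] comp W V →
                    ∀ f → comp f V n ≈ invFact inv n * iterate (lie W) f n 0
      comp-taylor zero    _       f = trans (comp-0 f) (sym (*-identityˡ (f 0)))
      comp-taylor (suc n) V′≈W∘V f = begin
        comp f V (suc n)                                  ≈⟨ inv*⊗ inv-inverse n _ ⟨
        inv n * deriv (comp f V) n                        ≈⟨ *-congˡ (comp-deriv n f) ⟩
        inv n * mul (comp (deriv f) V) (deriv V) n        ≈⟨ *-congˡ (mul-congʳ-≤ n V′≈W∘V) ⟩
        inv n * mul (comp (deriv f) V) (comp W V) n       ≈⟨ *-congˡ (comp-mul n (deriv f) W) ⟨
        inv n * comp (lie W f) V n
          ≈⟨ *-congˡ (comp-taylor n (V′≈W∘V ∘ ℕ.m<n⇒m<1+n) (lie W f)) ⟩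
        inv n * (invFact inv n * iterate (lie W) (lie W f) n 0)
          ≈⟨ *-assoc _ _ _ ⟨
        invFact inv (suc n) * iterate (lie W) f (suc n) 0 ∎
        where open ≈-Reasoning

  module ODE {inv : ℕ → Carrier} (inv-inverse : ∀ n → suc n ⊗ inv n ≈ 1#) (Wₙ : ℕ → Carrier) where

    W V : Series
    W = Wser inv Wₙ
    V = scale (Wₙ 0) (U inv Wₙ)

    open Composition V (zeroʳ (Wₙ 0))

    deriv-U : deriv (U inv Wₙ) ≈ₛ ζ inv Wₙ
    deriv-U n = ⊗*inv inv-inverse n (ζ inv Wₙ n)

    W*G≈fold-lie : ∀ n → mul W (G W n) ≈ₛ fold W (lie W) n
    W*G≈fold-lie zero    = mul-identityʳ W
    W*G≈fold-lie (suc n) k = trans (mul-comm W (G W (suc n)) k) (lie-cong W (W*G≈fold-lie n) k)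

    deriv-V≈comp-W : ∀ n → deriv V n ≈ comp W V n
    deriv-V≈comp-W = <-rec _ step
      where
      step : ∀ n → deriv V ≈[< n ] comp W V → deriv V n ≈ comp W V n
      step n V′≈W∘V = begin
        deriv V n                              ≈⟨ deriv-scale (Wₙ 0) (U inv Wₙ) n ⟩
        Wₙ 0 * deriv (U inv Wₙ) n              ≈⟨ *-congˡ (deriv-U n) ⟩
        Wₙ 0 * (G W n 0 * invFact inv n)       ≈⟨ *-CS.x∙yz≈z∙xy _ _ _ ⟩
        invFact inv n * (Wₙ 0 * G W n 0)
          ≈⟨ *-congˡ (trans (+-identityˡ _) (*-congʳ (*-identityʳ _))) ⟨
        invFact inv n * mul W (G W n) 0        ≈⟨ *-congˡ (W*G≈fold-lie n 0) ⟩
        invFact inv n * fold W (lie W) n 0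
          ≡⟨ ≡.cong (λ h → invFact inv n * h 0) (iterate-is-fold W (lie W) n) ⟩
        invFact inv n * iterate (lie W) W n 0  ≈⟨ comp-taylor inv-inverse W n V′≈W∘V W ⟨
        comp W V n                             ∎
        where open ≈-Reasoning

theorem11p7 : ∀ {c ℓ : Level} (R : CommutativeRing c ℓ)
    (inv : ℕ → CommutativeRing.Carrier R)
    → (∀ n → CommutativeRing._≈_ R (PowerSeries._⊗_ R (suc n) (inv n)) (CommutativeRing.1# R))
    → (Wₙ : ℕ → CommutativeRing.Carrier R)
    → ((n : ℕ) → CommutativeRing._≈_ R
          (PowerSeries.scale R (Wₙ 0) (PowerSeries.deriv R (PowerSeries.U R inv Wₙ)) n)
          (PowerSeries.comp R (PowerSeries.Wser R inv Wₙ)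
             (PowerSeries.scale R (Wₙ 0) (PowerSeries.U R inv Wₙ)) n))
      × CommutativeRing._≈_ R (PowerSeries.U R inv Wₙ 0) (CommutativeRing.0# R)
theorem11p7 R inv inv-inverse Wₙ =
  (λ n → trans (sym (deriv-scale (Wₙ 0) (U inv Wₙ) n)) (deriv-V≈comp-W n)) , refl
  where
  open CommutativeRing R using (refl; sym; trans)
  open PowerSeries R using (U)
  open FormalPowerSeries R
  open ODE inv-inverse Wₙ
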